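{- Let $m$ be a positive square-free integer and let $V(\sqrt m)_{1,2}\subset\mathbb{A}^3$, with coordinates $(y_1,x_1,x_2)$, be defined by \[ x_1x_2-2y_1x_1=0,\qquad y_1^2x_1-y_1x_1x_2-x_2=-mx_1. \] Then the set of integer points $(y_1,x_1,x_2)\in\mathbb{Z}^3$ on $V(\sqrt m)_{1,2}$ with $x_1\neq0$, $x_2\neq0$ equals \[ \{\pm(st,2s,2st)\mid s,t\in\mathbb{Z}\setminus\{0\},\ m=s^2t^2+t\}\ \cup\ \{\pm(st,s,2st)\mid s,t\in\mathbb{Z}\setminus\{0\},\ m=s^2t^2+2t\}. \] -}

module Defs where

open import Data.Nat as ℕ using (ℕ)
open import Data.Nat.Divisibility using (_∣_)
open import Data.Integer as ℤ using (ℤ; +_; _+_; _-_; _*_; -_; 0ℤ; 1ℤ)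
open import Data.Product using (Σ; ∃; _×_; _,_)
open import Data.Sum using (_⊎_)
open import Relation.Binary.PropositionalEquality using (_≡_; _≢_)

SquareFree : ℕ → Set
SquareFree m = ∀ (d : ℕ) → (d ℕ.* d) ∣ m → d ≡ 1

OnV : ℤ → ℤ → ℤ → ℤ → Set
OnV m y₁ x₁ x₂ =
  (x₁ * x₂ - + 2 * y₁ * x₁ ≡ 0ℤ)
  × (y₁ * y₁ * x₁ - y₁ * x₁ * x₂ - x₂ ≡ - (m * x₁))

IsSign : ℤ → Set
IsSign ε = (ε ≡ 1ℤ) ⊎ (ε ≡ - 1ℤ)

Family1 : ℤ → ℤ → ℤ → ℤ → Set
Family1 m y₁ x₁ x₂ =
  ∃ λ (s : ℤ) → ∃ λ (t : ℤ) → ∃ λ (ε : ℤ) →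
    s ≢ 0ℤ × t ≢ 0ℤ × IsSign ε
    × m ≡ s * s * t * t + t
    × y₁ ≡ ε * (s * t) × x₁ ≡ ε * (+ 2 * s) × x₂ ≡ ε * (+ 2 * s * t)

Family2 : ℤ → ℤ → ℤ → ℤ → Set
Family2 m y₁ x₁ x₂ =
  ∃ λ (s : ℤ) → ∃ λ (t : ℤ) → ∃ λ (ε : ℤ) →
    s ≢ 0ℤ × t ≢ 0ℤ × IsSign ε
    × m ≡ s * s * t * t + + 2 * t
    × y₁ ≡ ε * (s * t) × x₁ ≡ ε * s × x₂ ≡ ε * (+ 2 * s * t)

{-# OPTIONS --safe #-}
module Submission where

open import Defs
open import Data.Nat using (ℕ; NonZero)
open import Data.Integer using (ℤ; +_; 0ℤ; 1ℤ; _+_; _-_; _*_; -_; _%ℕ_; _/ℕ_)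
open import Data.Integer.Properties
  using (*-identityˡ; *-zeroʳ; *-assoc; *-comm; *-cancelˡ-≡; -1*i≡-i; neg-involutive; i*j≡0⇒i≡0∨j≡0; i-j≡0⇒i≡j)
open import Data.Integer.DivMod using (a≡a%ℕn+[a/ℕn]*n; n%ℕd<d)
open import Data.Integer.Tactic.RingSolver using (solve-∀)
import Data.Nat as ℕ
open import Data.Product using (∃; _×_; _,_)
open import Data.Sum using (_⊎_; inj₁; inj₂; [_,_])
open import Function.Bundles using (_⇔_; mk⇔)
open import Relation.Binary.PropositionalEquality using (_≡_; _≢_; refl; sym; trans; cong; module ≡-Reasoning)
open import Relation.Nullary using (contradiction)
open ≡-Reasoning

-- On V with x₁ ≠ 0 the first equation gives x₂ = 2y₁, and the second then becomes
-- x₁ (m − y₁²) = 2y₁.  If x₁ = 2s this says y₁ = s t with t = m − y₁²; if x₁ = s = 1 + 2q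
-- is odd, then m − y₁² = 2t is even, with t = y₁ − q (m − y₁²), and y₁ = s t.  Conversely
-- both families lie on V, and V is stable under (y₁,x₁,x₂) ↦ −(y₁,x₁,x₂), which accounts
-- for the signs (they are redundant, as s may be negative).  Neither m > 0 nor
-- square-freeness is used: the description holds for every integer m.

Solution : ℤ → ℤ → ℤ → ℤ → Set
Solution M y₁ x₁ x₂ = OnV M y₁ x₁ x₂ × x₁ ≢ 0ℤ × x₂ ≢ 0ℤ

i≢0∧j≢0⇒i*j≢0 : ∀ {i j} → i ≢ 0ℤ → j ≢ 0ℤ → i * j ≢ 0ℤ
i≢0∧j≢0⇒i*j≢0 {i} i≢0 j≢0 ij≡0 = [ i≢0 , j≢0 ] (i*j≡0⇒i≡0∨j≡0 i ij≡0)

-i≢0 : ∀ {i} → i ≢ 0ℤ → - i ≢ 0ℤ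
-i≢0 {i} i≢0 -i≡0 = i≢0 (trans (sym (neg-involutive i)) (cong -_ -i≡0))

neg-closed⇒sign-closed : ∀ {ε} → IsSign ε → (P : ℤ → ℤ → ℤ → Set) →
  (∀ a b c → P a b c → P (- a) (- b) (- c)) →
  ∀ a b c → P a b c → P (ε * a) (ε * b) (ε * c)
neg-closed⇒sign-closed (inj₁ refl) P neg a b c p
  rewrite *-identityˡ a | *-identityˡ b | *-identityˡ c = p
neg-closed⇒sign-closed (inj₂ refl) P neg a b c p
  rewrite -1*i≡-i a | -1*i≡-i b | -1*i≡-i c = neg a b c p

onV-neg : ∀ M y₁ x₁ x₂ → OnV M y₁ x₁ x₂ → OnV M (- y₁) (- x₁) (- x₂)
onV-neg M y₁ x₁ x₂ (e₁ , e₂) =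
  trans (first y₁ x₁ x₂) e₁ ,
  trans (second y₁ x₁ x₂) (trans (cong -_ e₂) (right M x₁))
  where
  first : ∀ y₁ x₁ x₂ → - x₁ * - x₂ - + 2 * - y₁ * - x₁ ≡ x₁ * x₂ - + 2 * y₁ * x₁
  first = solve-∀
  second : ∀ y₁ x₁ x₂ → - y₁ * - y₁ * - x₁ - - y₁ * - x₁ * - x₂ - - x₂
                      ≡ - (y₁ * y₁ * x₁ - y₁ * x₁ * x₂ - x₂)
  second = solve-∀
  right : ∀ M x₁ → - - (M * x₁) ≡ - (M * - x₁)
  right = solve-∀

solution-neg : ∀ M y₁ x₁ x₂ → Solution M y₁ x₁ x₂ → Solution M (- y₁) (- x₁) (- x₂)
solution-neg M y₁ x₁ x₂ (onV , x₁≢0 , x₂≢0) = onV-neg M y₁ x₁ x₂ onV , -i≢0 x₁≢0 , -i≢0 x₂≢0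

2≢0 : + 2 ≢ 0ℤ
2≢0 ()

family₁-solution : ∀ s t → s ≢ 0ℤ → t ≢ 0ℤ →
  Solution (s * s * t * t + t) (s * t) (+ 2 * s) (+ 2 * s * t)
family₁-solution s t s≢0 t≢0 =
  (first s t , second s t) , 2s≢0 , i≢0∧j≢0⇒i*j≢0 2s≢0 t≢0
  where
  2s≢0 : + 2 * s ≢ 0ℤ
  2s≢0 = i≢0∧j≢0⇒i*j≢0 2≢0 s≢0
  first : ∀ s t → + 2 * s * (+ 2 * s * t) - + 2 * (s * t) * (+ 2 * s) ≡ 0ℤ
  first = solve-∀
  second : ∀ s t → s * t * (s * t) * (+ 2 * s) - s * t * (+ 2 * s) * (+ 2 * s * t) - + 2 * s * t
                 ≡ - ((s * s * t * t + t) * (+ 2 * s))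
  second = solve-∀

family₂-solution : ∀ s t → s ≢ 0ℤ → t ≢ 0ℤ →
  Solution (s * s * t * t + + 2 * t) (s * t) s (+ 2 * s * t)
family₂-solution s t s≢0 t≢0 =
  (first s t , second s t) , s≢0 , i≢0∧j≢0⇒i*j≢0 (i≢0∧j≢0⇒i*j≢0 2≢0 s≢0) t≢0
  where
  first : ∀ s t → s * (+ 2 * s * t) - + 2 * (s * t) * s ≡ 0ℤ
  first = solve-∀
  second : ∀ s t → s * t * (s * t) * s - s * t * s * (+ 2 * s * t) - + 2 * s * t
                 ≡ - ((s * s * t * t + + 2 * t) * s)
  second = solve-∀

family⇒solution : ∀ {M y₁ x₁ x₂} → Family1 M y₁ x₁ x₂ ⊎ Family2 M y₁ x₁ x₂ → Solution M y₁ x₁ x₂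
family⇒solution (inj₁ (s , t , ε , s≢0 , t≢0 , ε± , refl , refl , refl , refl)) =
  neg-closed⇒sign-closed ε± (Solution M) (solution-neg M) (s * t) (+ 2 * s) (+ 2 * s * t)
    (family₁-solution s t s≢0 t≢0)
  where
  M : ℤ
  M = s * s * t * t + t
family⇒solution (inj₂ (s , t , ε , s≢0 , t≢0 , ε± , refl , refl , refl , refl)) =
  neg-closed⇒sign-closed ε± (Solution M) (solution-neg M) (s * t) s (+ 2 * s * t)
    (family₂-solution s t s≢0 t≢0)
  where
  M : ℤ
  M = s * s * t * t + + 2 * t

onV⇒x₂≡2y₁ : ∀ M y₁ x₁ x₂ → x₁ ≢ 0ℤ → OnV M y₁ x₁ x₂ → x₂ ≡ + 2 * y₁
onV⇒x₂≡2y₁ M y₁ x₁ x₂ x₁≢0 (e₁ , _) =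
  [ (λ x₁≡0 → contradiction x₁≡0 x₁≢0) , i-j≡0⇒i≡j x₂ (+ 2 * y₁) ]
    (i*j≡0⇒i≡0∨j≡0 x₁ (trans (factor y₁ x₁ x₂) e₁))
  where
  factor : ∀ y₁ x₁ x₂ → x₁ * (x₂ - + 2 * y₁) ≡ x₁ * x₂ - + 2 * y₁ * x₁
  factor = solve-∀

onV⇒x₁[M-y₁²]≡2y₁ : ∀ M y₁ x₁ → OnV M y₁ x₁ (+ 2 * y₁) → x₁ * (M - y₁ * y₁) ≡ + 2 * y₁
onV⇒x₁[M-y₁²]≡2y₁ M y₁ x₁ (_ , e₂) = begin
  x₁ * (M - y₁ * y₁)
    ≡⟨ expand M y₁ x₁ ⟩
  M * x₁ + (y₁ * y₁ * x₁ - y₁ * x₁ * (+ 2 * y₁) - + 2 * y₁) + + 2 * y₁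
    ≡⟨ cong (λ z → M * x₁ + z + + 2 * y₁) e₂ ⟩
  M * x₁ + - (M * x₁) + + 2 * y₁
    ≡⟨ cancel M y₁ x₁ ⟩
  + 2 * y₁ ∎
  where
  expand : ∀ M y₁ x₁ → x₁ * (M - y₁ * y₁)
                     ≡ M * x₁ + (y₁ * y₁ * x₁ - y₁ * x₁ * (+ 2 * y₁) - + 2 * y₁) + + 2 * y₁
  expand = solve-∀
  cancel : ∀ M y₁ x₁ → M * x₁ + - (M * x₁) + + 2 * y₁ ≡ + 2 * y₁
  cancel = solve-∀

parity : ∀ x → ∃ λ q → x ≡ + 2 * q ⊎ x ≡ 1ℤ + + 2 * q
parity x with x %ℕ 2 | n%ℕd<d x 2 | a≡a%ℕn+[a/ℕn]*n x 2
... | 0 | _ | x≡0+q2 = x /ℕ 2 , inj₁ (trans x≡0+q2 (even (x /ℕ 2)))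
  where
  even : ∀ q → + 0 + q * + 2 ≡ + 2 * q
  even = solve-∀
... | 1 | _ | x≡1+q2 = x /ℕ 2 , inj₂ (trans x≡1+q2 (cong (_+_ 1ℤ) (*-comm (x /ℕ 2) (+ 2))))
... | ℕ.suc (ℕ.suc _) | ℕ.s≤s (ℕ.s≤s ()) | _

[1+2q]k≡2y⇒k≡2[y-qk] : ∀ q k y → (1ℤ + + 2 * q) * k ≡ + 2 * y → k ≡ + 2 * (y - q * k)
[1+2q]k≡2y⇒k≡2[y-qk] q k y e = begin
  k                                   ≡⟨ split q k ⟩
  (1ℤ + + 2 * q) * k - + 2 * (q * k)  ≡⟨ cong (_- + 2 * (q * k)) e ⟩
  + 2 * y - + 2 * (q * k)             ≡⟨ factor q k y ⟩
  + 2 * (y - q * k)                   ∎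
  where
  split : ∀ q k → k ≡ (1ℤ + + 2 * q) * k - + 2 * (q * k)
  split = solve-∀
  factor : ∀ q k y → + 2 * y - + 2 * (q * k) ≡ + 2 * (y - q * k)
  factor = solve-∀

family₁-intro : ∀ {M y₁ x₁} s t → s ≢ 0ℤ → y₁ ≢ 0ℤ → y₁ ≡ s * t → x₁ ≡ + 2 * s →
  M ≡ y₁ * y₁ + t → Family1 M y₁ x₁ (+ 2 * y₁)
family₁-intro s t s≢0 y₁≢0 refl refl M≡ =
  s , t , 1ℤ , s≢0 , (λ { refl → y₁≢0 (*-zeroʳ s) }) , inj₁ refl ,
  trans M≡ (regroup s t) , sym (*-identityˡ _) , sym (*-identityˡ _) ,
  trans (sym (*-assoc (+ 2) s t)) (sym (*-identityˡ _))
  where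
  regroup : ∀ s t → s * t * (s * t) + t ≡ s * s * t * t + t
  regroup = solve-∀

family₂-intro : ∀ {M y₁ x₁} s t → s ≢ 0ℤ → y₁ ≢ 0ℤ → y₁ ≡ s * t → x₁ ≡ s →
  M ≡ y₁ * y₁ + + 2 * t → Family2 M y₁ x₁ (+ 2 * y₁)
family₂-intro s t s≢0 y₁≢0 refl refl M≡ =
  s , t , 1ℤ , s≢0 , (λ { refl → y₁≢0 (*-zeroʳ s) }) , inj₁ refl ,
  trans M≡ (regroup s t) , sym (*-identityˡ _) , sym (*-identityˡ _) ,
  trans (sym (*-assoc (+ 2) s t)) (sym (*-identityˡ _))
  where
  regroup : ∀ s t → s * t * (s * t) + + 2 * t ≡ s * s * t * t + + 2 * t
  regroup = solve-∀

M≡y²+[M-y²] : ∀ M y → M ≡ y * y + (M - y * y)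
M≡y²+[M-y²] = solve-∀

x₁[M-y₁²]≡2y₁⇒family : ∀ M y₁ x₁ → x₁ ≢ 0ℤ → y₁ ≢ 0ℤ → x₁ * (M - y₁ * y₁) ≡ + 2 * y₁ →
  Family1 M y₁ x₁ (+ 2 * y₁) ⊎ Family2 M y₁ x₁ (+ 2 * y₁)
x₁[M-y₁²]≡2y₁⇒family M y₁ x₁ x₁≢0 y₁≢0 e with parity x₁
... | s , inj₁ refl = inj₁ (family₁-intro s k (λ { refl → x₁≢0 refl }) y₁≢0 y₁≡sk refl (M≡y²+[M-y²] M y₁))
  where
  k : ℤ
  k = M - y₁ * y₁
  y₁≡sk : y₁ ≡ s * k
  y₁≡sk = *-cancelˡ-≡ (+ 2) y₁ (s * k) (trans (sym e) (*-assoc (+ 2) s k))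
... | q , inj₂ refl = inj₂ (family₂-intro s t x₁≢0 y₁≢0 y₁≡st refl M≡y₁²+2t)
  where
  s : ℤ
  s = 1ℤ + + 2 * q
  k : ℤ
  k = M - y₁ * y₁
  t : ℤ
  t = y₁ - q * k
  k≡2t : k ≡ + 2 * t
  k≡2t = [1+2q]k≡2y⇒k≡2[y-qk] q k y₁ e
  M≡y₁²+2t : M ≡ y₁ * y₁ + + 2 * t
  M≡y₁²+2t = trans (M≡y²+[M-y²] M y₁) (cong (_+_ (y₁ * y₁)) k≡2t)
  y₁≡st : y₁ ≡ s * t
  y₁≡st = *-cancelˡ-≡ (+ 2) y₁ (s * t) (begin
    + 2 * y₁      ≡⟨ e ⟨
    s * k         ≡⟨ cong (s *_) k≡2t ⟩
    s * (+ 2 * t) ≡⟨ swap s t ⟩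
    + 2 * (s * t) ∎)
    where
    swap : ∀ s t → s * (+ 2 * t) ≡ + 2 * (s * t)
    swap = solve-∀

solution⇒family : ∀ M y₁ x₁ x₂ → Solution M y₁ x₁ x₂ → Family1 M y₁ x₁ x₂ ⊎ Family2 M y₁ x₁ x₂
solution⇒family M y₁ x₁ x₂ (onV , x₁≢0 , x₂≢0) with onV⇒x₂≡2y₁ M y₁ x₁ x₂ x₁≢0 onV
... | refl = x₁[M-y₁²]≡2y₁⇒family M y₁ x₁ x₁≢0 (λ { refl → x₂≢0 refl }) (onV⇒x₁[M-y₁²]≡2y₁ M y₁ x₁ onV)

corollary3p5 : (m : ℕ) → NonZero m → SquareFree m →
    (y₁ x₁ x₂ : ℤ) →
    (OnV (+ m) y₁ x₁ x₂ × x₁ ≢ 0ℤ × x₂ ≢ 0ℤ) ⇔ (Family1 (+ m) y₁ x₁ x₂ ⊎ Family2 (+ m) y₁ x₁ x₂)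
corollary3p5 m _ _ y₁ x₁ x₂ = mk⇔ (solution⇒family (+ m) y₁ x₁ x₂) family⇒solution
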